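{- Let $G=(V_G,E_G)$ and $H=(V_H,E_H)$ be finite simple connected graphs with $|V_G|=n$ and $|V_H|=m$. Then $$W(G\wr H)=n^3m^{2(n-1)}W(H)+m^n\sum_{k=0}^{n}(m-1)^k\,W_{\rho_k}(G).$$
   Context: The wreath product $G\wr H$ has vertex set $\{(f,v): f:V_G\to V_H,\ v\in V_G\}$; $(f,v)$ and $(f',v')$ are adjacent iff either $v=v'$, $f(w)=f'(w)$ for $w\neq v$ and $f(v)\sim f'(v)$ in $H$, or $f=f'$ and $v\sim v'$ in $G$. The Wiener index of a connected graph $X$ is $W(X)=\frac12\sum_{u,v\in V_X}d_X(u,v)$. For $A\subseteq V_G$ and $u,v\in V_G$, $\rho_A(u,v)$ is the minimum length of a walk in $G$ from $u$ to $v$ (vertex repetitions allowed, length $\ge0$) visiting every vertex of $A$; $W_{\rho_A}(G)=\frac12\sum_{u,v\in V_G}\rho_A(u,v)$ (all ordered pairs including $u=v$), and $W_{\rho_k}(G)=\sum_{A\subseteq V_G,\ |A|=k}W_{\rho_A}(G)$ for $k=0,\ldots,n$. The convention $0^0=1$ is used. -}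

module Defs where

open import Data.Nat as ℕ using (ℕ; zero; suc; _∸_)
open import Data.Nat.Properties using (_≟_)
open import Data.Fin using (Fin)
open import Data.Vec using (Vec; []; _∷_; lookup)
open import Data.List as L using (List; []; _∷_; concatMap; allFin)
open import Data.Nat.ListAction using (sum)
open import Data.Bool using (Bool; true; false; if_then_else_)
open import Data.Integer using (+_)
open import Data.Rational as ℚ using (ℚ)
open import Data.Product using (Σ; _×_; _,_)
open import Data.Sum using (_⊎_)
open import Data.Empty using (⊥)
open import Relation.Nullary using (¬_; Dec)
open import Relation.Nullary.Decidable using (⌊_⌋)
open import Relation.Binary.PropositionalEquality using (_≡_; _≢_)
open import Data.Fin.Subset using (Subset; _∈_; ∣_∣)

record SimpleGraph (n : ℕ) : Set₁ where
  field
    Adj    : Fin n → Fin n → Set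
    adj?   : ∀ u v → Dec (Adj u v)
    sym    : ∀ {u v} → Adj u v → Adj v u
    irrefl : ∀ {u} → ¬ Adj u u
open SimpleGraph public

data Walk {V : Set} (R : V → V → Set) : V → V → Set where
  [_]   : (v : V) → Walk R v v
  _∷⟨_⟩_ : ∀ {w v} (u : V) → R u w → Walk R w v → Walk R u v

walkLength : ∀ {V : Set} {R : V → V → Set} {u v} → Walk R u v → ℕ
walkLength [ _ ] = 0
walkLength (_ ∷⟨ _ ⟩ p) = suc (walkLength p)

data _visitedBy_ {V : Set} {R : V → V → Set} (x : V) : ∀ {u v} → Walk R u v → Set where
  here-end : x visitedBy ([ x ] {- -})
  here     : ∀ {w v} (r : R x w) (p : Walk R w v) → x visitedBy (x ∷⟨ r ⟩ p)
  there    : ∀ {u w v} (r : R u w) (p : Walk R w v) → x visitedBy p → x visitedBy (u ∷⟨ r ⟩ p)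

Connected : ∀ {n} → SimpleGraph n → Set
Connected G = ∀ u v → Walk (Adj G) u v

IsDistance : {V : Set} (R : V → V → Set) (d : V → V → ℕ) → Set
IsDistance R d = ∀ u v →
  Σ (Walk R u v) (λ p → walkLength p ≡ d u v) ×
  (∀ (p : Walk R u v) → d u v ℕ.≤ walkLength p)

IsRho : ∀ {n} (G : SimpleGraph n) (ρ : Subset n → Fin n → Fin n → ℕ) → Set
IsRho {n} G ρ = ∀ (A : Subset n) u v →
  Σ (Walk (Adj G) u v) (λ p → (∀ a → a ∈ A → a visitedBy p) × walkLength p ≡ ρ A u v) ×
  (∀ (p : Walk (Adj G) u v) → (∀ a → a ∈ A → a visitedBy p) → ρ A u v ℕ.≤ walkLength p)

-- Wreath product G ≀ H : vertices (f , v) with f : V_G → V_H (as a vector)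

WVertex : ℕ → ℕ → Set
WVertex n m = Vec (Fin m) n × Fin n

WreathAdj : ∀ {n m} → SimpleGraph n → SimpleGraph m → WVertex n m → WVertex n m → Set
WreathAdj G H (f , v) (f' , v') =
  (v ≡ v' × (∀ w → w ≢ v → lookup f w ≡ lookup f' w) × Adj H (lookup f v) (lookup f' v))
  ⊎ (f ≡ f' × Adj G v v')

allVecs : (n : ℕ) {A : Set} → List A → List (Vec A n)
allVecs zero    xs = [] ∷ []
allVecs (suc n) xs = concatMap (λ x → L.map (x ∷_) (allVecs n xs)) xs

allFunctions : (n m : ℕ) → List (Vec (Fin m) n)
allFunctions n m = allVecs n (allFin m)

allSubsets : (n : ℕ) → List (Subset n)
allSubsets n = allVecs n (true ∷ false ∷ [])

allWVertices : (n m : ℕ) → List (WVertex n m)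
allWVertices n m = concatMap (λ f → L.map (f ,_) (allFin n)) (allFunctions n m)

sumOver : {A : Set} → List A → (A → ℕ) → ℕ
sumOver xs g = sum (L.map g xs)

sumℚ : {A : Set} → List A → (A → ℚ) → ℚ
sumℚ [] g = ℚ.0ℚ
sumℚ (x ∷ xs) g = g x ℚ.+ sumℚ xs g

half : ℕ → ℚ
half s = (+ s) ℚ./ 2

-- Wiener-type indices  (½ Σ over all ordered pairs, including u = v)

wienerFin : (n : ℕ) → (Fin n → Fin n → ℕ) → ℚ
wienerFin n d = half (sumOver (allFin n) λ u → sumOver (allFin n) λ v → d u v)

wienerWreath : (n m : ℕ) → (WVertex n m → WVertex n m → ℕ) → ℚ
wienerWreath n m d =
  half (sumOver (allWVertices n m) λ x → sumOver (allWVertices n m) λ y → d x y)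

wienerRhoA : (n : ℕ) → (Subset n → Fin n → Fin n → ℕ) → Subset n → ℚ
wienerRhoA n ρ A = wienerFin n (ρ A)

wienerRhoK : (n : ℕ) → (Subset n → Fin n → Fin n → ℕ) → ℕ → ℚ
wienerRhoK n ρ k =
  sumℚ (allSubsets n) λ A → if ⌊ ∣ A ∣ ≟ k ⌋ then wienerRhoA n ρ A else ℚ.0ℚ

fromℕ : ℕ → ℚ
fromℕ k = (+ k) ℚ./ 1

-- A walk in G ≀ H from (f , v) to (f′ , v′) has to pass through every vertex w of G at which f and f′
-- differ and spend at least d_H (f w) (f′ w) fibre steps there; conversely, following a walk of G that
-- visits all these vertices and repairing each coordinate along an H-geodesic on arrival achieves this.
-- Hence d((f , v) , (f′ , v′)) = Σ_w d_H (f w) (f′ w) + ρ_A (v , v′) with A the set where f and f′ differ.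
-- Summing over all pairs, at each of the n coordinates a fixed pair of values occurs for m^(n-1) · m^(n-1)
-- pairs (f , f′), which with the n² choices of (v , v′) gives the W(H) term, and each A ⊆ V_G is the
-- difference set of exactly m^n (m-1)^|A| pairs (f , f′), which gives the W_ρ terms.

module Submission where

module WreathProductWiener where
  open import Defs hiding (sym)
  open import Data.Nat as ℕ using (ℕ; zero; suc; _+_; _*_; _^_; _∸_; _≤_; _<_; s≤s)
  open import Data.Nat.Properties
  open import Data.Nat.ListAction using (sum)
  open import Data.Nat.Tactic.RingSolver using (solve-∀)
  open import Algebra.Properties.CommutativeSemigroup +-commutativeSemigroup using (interchange)
  import Data.Integer as ℤ
  import Data.Integer.Properties as ℤ
  import Data.Integer.Tactic.RingSolver as ℤ-Solver
  open import Data.Rational as ℚ using (ℚ)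
  open import Data.Rational.Properties using (toℚᵘ-injective; toℚᵘ-fromℚᵘ; toℚᵘ-homo-+; toℚᵘ-homo-*)
  open import Data.Rational.Unnormalised as ℚᵘ using (mkℚᵘ; *≡*)
  import Data.Rational.Unnormalised.Properties as ℚᵘ
  open import Data.Bool using (Bool; true; false; not; if_then_else_)
  open import Data.Fin as Fin using (Fin)
  import Data.Fin.Properties as Fin
  open import Data.Fin.Subset using (Subset; ∣_∣; _∈_)
  open import Data.Fin.Subset.Properties using (∣p∣≤n)
  open import Data.Vec as Vec using (Vec; lookup; _[_]≔_)
  import Data.Vec.Properties as Vec
  open import Data.List as List using (List; []; _∷_; _++_; concatMap; allFin; length; upTo)
  import Data.List.Properties as List
  open import Data.Product using (Σ; _×_; _,_; proj₁; proj₂)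
  open import Data.Sum using (inj₁; inj₂)
  open import Function using (id)
  open import Relation.Nullary using (Dec; yes; no; contradiction)
  open import Relation.Nullary.Decidable using (⌊_⌋; does; decidable-stable; dec-true; dec-false)
  open import Relation.Binary.PropositionalEquality
  open ≡-Reasoning

  module _ {A : Set} where

    sumOver-cong : (xs : List A) {g h : A → ℕ} → (∀ a → g a ≡ h a) → sumOver xs g ≡ sumOver xs h
    sumOver-cong []       e = refl
    sumOver-cong (x ∷ xs) e = cong₂ _+_ (e x) (sumOver-cong xs e)

    sumOver-++ : (xs ys : List A) (g : A → ℕ) → sumOver (xs ++ ys) g ≡ sumOver xs g + sumOver ys g
    sumOver-++ []       ys g = refl
    sumOver-++ (x ∷ xs) ys g = trans (cong (g x +_) (sumOver-++ xs ys g)) (sym (+-assoc (g x) _ _))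

    sumOver-+ : (xs : List A) (g h : A → ℕ) → sumOver xs (λ a → g a + h a) ≡ sumOver xs g + sumOver xs h
    sumOver-+ []       g h = refl
    sumOver-+ (x ∷ xs) g h = trans (cong (g x + h x +_) (sumOver-+ xs g h)) (interchange (g x) (h x) _ _)

    sumOver-* : (xs : List A) (c : ℕ) (g : A → ℕ) → sumOver xs (λ a → c * g a) ≡ c * sumOver xs g
    sumOver-* []       c g = sym (*-zeroʳ c)
    sumOver-* (x ∷ xs) c g = trans (cong (c * g x +_) (sumOver-* xs c g)) (sym (*-distribˡ-+ c (g x) _))

    sumOver-const : (xs : List A) (c : ℕ) → sumOver xs (λ _ → c) ≡ length xs * c
    sumOver-const []       c = refl
    sumOver-const (x ∷ xs) c = cong (c +_) (sumOver-const xs c)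

    sumOver-map : {B : Set} (k : B → A) (ys : List B) (g : A → ℕ) →
      sumOver (List.map k ys) g ≡ sumOver ys (λ b → g (k b))
    sumOver-map k []       g = refl
    sumOver-map k (y ∷ ys) g = cong (g (k y) +_) (sumOver-map k ys g)

    sumOver-concatMap : {B : Set} (h : B → List A) (ys : List B) (g : A → ℕ) →
      sumOver (concatMap h ys) g ≡ sumOver ys (λ b → sumOver (h b) g)
    sumOver-concatMap h []       g = refl
    sumOver-concatMap h (y ∷ ys) g =
      trans (sumOver-++ (h y) (concatMap h ys) g) (cong (sumOver (h y) g +_) (sumOver-concatMap h ys g))

  sumOver-comm : {A B : Set} (xs : List A) (ys : List B) (g : A → B → ℕ) →
    sumOver xs (λ a → sumOver ys (g a)) ≡ sumOver ys (λ b → sumOver xs (λ a → g a b))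
  sumOver-comm []       ys g = sym (trans (sumOver-const ys 0) (*-zeroʳ (length ys)))
  sumOver-comm (x ∷ xs) ys g = trans (cong (sumOver ys (g x) +_) (sumOver-comm xs ys g))
    (sym (sumOver-+ ys (g x) (λ b → sumOver xs (λ a → g a b))))

  sumOverPairs : {A : Set} → List A → (A → A → ℕ) → ℕ
  sumOverPairs xs g = sumOver xs λ a → sumOver xs (g a)

  module _ {A : Set} (xs : List A) where

    sumOverPairs-cong : {g h : A → A → ℕ} → (∀ a b → g a b ≡ h a b) → sumOverPairs xs g ≡ sumOverPairs xs h
    sumOverPairs-cong e = sumOver-cong xs λ a → sumOver-cong xs (e a)

    sumOverPairs-+ : (g h : A → A → ℕ) →
      sumOverPairs xs (λ a b → g a b + h a b) ≡ sumOverPairs xs g + sumOverPairs xs h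
    sumOverPairs-+ g h = trans (sumOver-cong xs λ a → sumOver-+ xs (g a) (h a)) (sumOver-+ xs _ _)

    sumOverPairs-* : (c : ℕ) (g : A → A → ℕ) → sumOverPairs xs (λ a b → c * g a b) ≡ c * sumOverPairs xs g
    sumOverPairs-* c g = trans (sumOver-cong xs λ a → sumOver-* xs c (g a)) (sumOver-* xs c _)

    sumOverPairs-const : (c : ℕ) → sumOverPairs xs (λ _ _ → c) ≡ length xs * (length xs * c)
    sumOverPairs-const c = trans (sumOver-cong xs λ _ → sumOver-const xs c) (sumOver-const xs _)

  length-allFin : ∀ n → length (allFin n) ≡ n
  length-allFin n = List.length-tabulate id

  sumOver-allFin-const : ∀ n c → sumOver (allFin n) (λ _ → c) ≡ n * c
  sumOver-allFin-const n c = trans (sumOver-const (allFin n) c) (cong (_* c) (length-allFin n))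

  sumOver-allFin-suc : ∀ n (g : Fin (suc n) → ℕ) →
    sumOver (allFin (suc n)) g ≡ g Fin.zero + sumOver (allFin n) (λ i → g (Fin.suc i))
  sumOver-allFin-suc n g = trans (sum-tabulate g) (cong (g Fin.zero +_) (sym (sum-tabulate (λ i → g (Fin.suc i)))))
    where
    sum-tabulate : ∀ {k} (h : Fin k → ℕ) → sumOver (allFin k) h ≡ sum (List.tabulate h)
    sum-tabulate h = cong sum (List.map-tabulate id h)

  sumOver-allVecs-suc : ∀ n {B : Set} (xs : List B) (g : Vec B (suc n) → ℕ) →
    sumOver (allVecs (suc n) xs) g ≡ sumOver xs (λ x → sumOver (allVecs n xs) (λ f → g (x Vec.∷ f)))
  sumOver-allVecs-suc n xs g = trans (sumOver-concatMap _ xs g) (sumOver-cong xs λ x → sumOver-map _ (allVecs n xs) g)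

  length-allVecs : ∀ n {B : Set} (xs : List B) → length (allVecs n xs) ≡ length xs ^ n
  length-allVecs zero    xs = refl
  length-allVecs (suc n) xs = begin
    length (allVecs (suc n) xs)                              ≡⟨ sym (sumOver-one (allVecs (suc n) xs)) ⟩
    sumOver (allVecs (suc n) xs) (λ _ → 1)                   ≡⟨ sumOver-allVecs-suc n xs _ ⟩
    sumOver xs (λ _ → sumOver (allVecs n xs) (λ _ → 1))      ≡⟨ sumOver-cong xs (λ _ → sumOver-one (allVecs n xs)) ⟩
    sumOver xs (λ _ → length (allVecs n xs))                 ≡⟨ sumOver-const xs _ ⟩
    length xs * length (allVecs n xs)                        ≡⟨ cong (length xs *_) (length-allVecs n xs) ⟩
    length xs * length xs ^ n                                ∎
    where
    sumOver-one : {A : Set} (ys : List A) → sumOver ys (λ _ → 1) ≡ length ys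
    sumOver-one ys = trans (sumOver-const ys 1) (*-identityʳ (length ys))

  length-allFunctions : ∀ n m → length (allFunctions n m) ≡ m ^ n
  length-allFunctions n m = trans (length-allVecs n (allFin m)) (cong (_^ n) (length-allFin m))

  sumOverPairs-allFunctions-suc : ∀ n m (g : Vec (Fin m) (suc n) → Vec (Fin m) (suc n) → ℕ) →
    sumOverPairs (allFunctions (suc n) m) g ≡
    sumOverPairs (allFin m) λ x y → sumOverPairs (allFunctions n m) λ f f' → g (x Vec.∷ f) (y Vec.∷ f')
  sumOverPairs-allFunctions-suc n m g = trans (sumOver-allVecs-suc n (allFin m) _) (sumOver-cong (allFin m) λ x →
    trans (sumOver-cong (allFunctions n m) λ f → sumOver-allVecs-suc n (allFin m) _)
          (sumOver-comm (allFunctions n m) (allFin m) _))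

  sumOverPairs-allFin-const : ∀ m c → sumOverPairs (allFin m) (λ _ _ → c) ≡ m * (m * c)
  sumOverPairs-allFin-const m c = trans (sumOverPairs-const (allFin m) c) (cong (λ k → k * (k * c)) (length-allFin m))

  sumOverPairs-allFunctions-const : ∀ n m c → sumOverPairs (allFunctions n m) (λ _ _ → c) ≡ m ^ n * (m ^ n * c)
  sumOverPairs-allFunctions-const n m c =
    trans (sumOverPairs-const (allFunctions n m) c) (cong (λ k → k * (k * c)) (length-allFunctions n m))

  sumOverPairs-allWVertices : ∀ n m (g : WVertex n m → WVertex n m → ℕ) →
    sumOverPairs (allWVertices n m) g ≡
    sumOverPairs (allFunctions n m) λ f f' → sumOverPairs (allFin n) λ v v' → g (f , v) (f' , v')
  sumOverPairs-allWVertices n m g = begin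
    sumOverPairs (allWVertices n m) g
      ≡⟨ sumOver-allWVertices _ ⟩
    sumOver Fs (λ f → sumOver (allFin n) λ v → sumOver (allWVertices n m) (g (f , v)))
      ≡⟨ sumOver-cong Fs (λ f → sumOver-cong (allFin n) λ v → sumOver-allWVertices _) ⟩
    sumOver Fs (λ f → sumOver (allFin n) λ v → sumOver Fs λ f' → sumOver (allFin n) λ v' → g (f , v) (f' , v'))
      ≡⟨ sumOver-cong Fs (λ f → sumOver-comm (allFin n) Fs _) ⟩
    sumOverPairs Fs (λ f f' → sumOverPairs (allFin n) λ v v' → g (f , v) (f' , v')) ∎
    where
    Fs = allFunctions n m
    sumOver-allWVertices : (h : WVertex n m → ℕ) →
      sumOver (allWVertices n m) h ≡ sumOver Fs (λ f → sumOver (allFin n) λ v → h (f , v))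
    sumOver-allWVertices h = trans (sumOver-concatMap _ Fs h) (sumOver-cong Fs λ f → sumOver-map _ (allFin n) h)

  coordinateDistance : ∀ {n m} → (Fin m → Fin m → ℕ) → Vec (Fin m) n → Vec (Fin m) n → ℕ
  coordinateDistance {n} d f f' = sumOver (allFin n) λ w → d (lookup f w) (lookup f' w)

  sumOver-allFin-update : ∀ {k} {B : Set} (F : Fin k → B → ℕ) (g : Vec B k) (u : Fin k) (y : B) →
    sumOver (allFin k) (λ w → F w (lookup (g [ u ]≔ y) w)) + F u (lookup g u)
    ≡ sumOver (allFin k) (λ w → F w (lookup g w)) + F u y
  sumOver-allFin-update {suc k} F (x Vec.∷ g) Fin.zero y = begin
    sumOver (allFin (suc k)) (λ w → F w (lookup (y Vec.∷ g) w)) + F Fin.zero x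
      ≡⟨ cong (_+ F Fin.zero x) (sumOver-allFin-suc k _) ⟩
    F Fin.zero y + S + F Fin.zero x
      ≡⟨ swap (F Fin.zero y) S (F Fin.zero x) ⟩
    F Fin.zero x + S + F Fin.zero y
      ≡⟨ cong (_+ F Fin.zero y) (sym (sumOver-allFin-suc k _)) ⟩
    sumOver (allFin (suc k)) (λ w → F w (lookup (x Vec.∷ g) w)) + F Fin.zero y ∎
    where
    S = sumOver (allFin k) (λ w → F (Fin.suc w) (lookup g w))
    swap : ∀ a s b → a + s + b ≡ b + s + a
    swap = solve-∀
  sumOver-allFin-update {suc k} F (x Vec.∷ g) (Fin.suc u) y = begin
    sumOver (allFin (suc k)) (λ w → F w (lookup ((x Vec.∷ g) [ Fin.suc u ]≔ y) w)) + F (Fin.suc u) (lookup g u)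
      ≡⟨ cong (_+ F (Fin.suc u) (lookup g u)) (sumOver-allFin-suc k _) ⟩
    F Fin.zero x + sumOver (allFin k) (λ w → F (Fin.suc w) (lookup (g [ u ]≔ y) w)) + F (Fin.suc u) (lookup g u)
      ≡⟨ +-assoc (F Fin.zero x) _ _ ⟩
    F Fin.zero x + (sumOver (allFin k) (λ w → F (Fin.suc w) (lookup (g [ u ]≔ y) w)) + F (Fin.suc u) (lookup g u))
      ≡⟨ cong (F Fin.zero x +_) (sumOver-allFin-update (λ w → F (Fin.suc w)) g u y) ⟩
    F Fin.zero x + (sumOver (allFin k) (λ w → F (Fin.suc w) (lookup g w)) + F (Fin.suc u) y)
      ≡⟨ sym (+-assoc (F Fin.zero x) _ _) ⟩
    F Fin.zero x + sumOver (allFin k) (λ w → F (Fin.suc w) (lookup g w)) + F (Fin.suc u) y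
      ≡⟨ cong (_+ F (Fin.suc u) y) (sym (sumOver-allFin-suc k _)) ⟩
    sumOver (allFin (suc k)) (λ w → F w (lookup (x Vec.∷ g) w)) + F (Fin.suc u) y ∎

  coordinateDistance-update : ∀ {n m} (d : Fin m → Fin m → ℕ) (g f' : Vec (Fin m) n) u y →
    coordinateDistance d (g [ u ]≔ y) f' + d (lookup g u) (lookup f' u) ≡ coordinateDistance d g f' + d y (lookup f' u)
  coordinateDistance-update d g f' u y = sumOver-allFin-update (λ w x → d x (lookup f' w)) g u y

  module _ (m : ℕ) (d : Fin m → Fin m → ℕ) where

    sumOverPairs-coordinateDistance-suc : ∀ n →
      sumOverPairs (allFunctions (suc n) m) (coordinateDistance d) ≡
      m ^ n * (m ^ n * sumOverPairs (allFin m) d) + m * (m * sumOverPairs (allFunctions n m) (coordinateDistance d))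
    sumOverPairs-coordinateDistance-suc n = begin
      sumOverPairs (allFunctions (suc n) m) (coordinateDistance d)
        ≡⟨ sumOverPairs-allFunctions-suc n m _ ⟩
      sumOverPairs (allFin m) (λ x y → sumOverPairs Fs λ f f' → coordinateDistance d (x Vec.∷ f) (y Vec.∷ f'))
        ≡⟨ sumOverPairs-cong (allFin m) (λ x y → trans (sumOverPairs-cong Fs λ f f' → sumOver-allFin-suc n _)
                                                         (sumOverPairs-+ Fs _ _)) ⟩
      sumOverPairs (allFin m) (λ x y → sumOverPairs Fs (λ _ _ → d x y) + P)
        ≡⟨ sumOverPairs-+ (allFin m) _ _ ⟩
      sumOverPairs (allFin m) (λ x y → sumOverPairs Fs (λ _ _ → d x y)) + sumOverPairs (allFin m) (λ _ _ → P)
        ≡⟨ cong₂ _+_ (sumOverPairs-cong (allFin m) λ x y → sumOverPairs-allFunctions-const n m (d x y))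
                     (sumOverPairs-allFin-const m P) ⟩
      sumOverPairs (allFin m) (λ x y → m ^ n * (m ^ n * d x y)) + m * (m * P)
        ≡⟨ cong (_+ m * (m * P)) (trans (sumOverPairs-* (allFin m) (m ^ n) _)
                                        (cong (m ^ n *_) (sumOverPairs-* (allFin m) (m ^ n) d))) ⟩
      m ^ n * (m ^ n * sumOverPairs (allFin m) d) + m * (m * P) ∎
      where
      Fs = allFunctions n m
      P = sumOverPairs Fs (coordinateDistance d)

    sumOverPairs-coordinateDistance : ∀ n →
      sumOverPairs (allFunctions (suc n) m) (coordinateDistance d) ≡ suc n * (m ^ n * m ^ n) * sumOverPairs (allFin m) d
    sumOverPairs-coordinateDistance zero = trans (sumOverPairs-coordinateDistance-suc 0) (base m S)
      where
      S = sumOverPairs (allFin m) d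
      base : ∀ m s → 1 * (1 * s) + m * (m * 0) ≡ 1 * (1 * 1) * s
      base = solve-∀
    sumOverPairs-coordinateDistance (suc n) = begin
      sumOverPairs (allFunctions (suc (suc n)) m) (coordinateDistance d)
        ≡⟨ sumOverPairs-coordinateDistance-suc (suc n) ⟩
      m ^ suc n * (m ^ suc n * S) + m * (m * sumOverPairs (allFunctions (suc n) m) (coordinateDistance d))
        ≡⟨ cong (λ z → m ^ suc n * (m ^ suc n * S) + m * (m * z)) (sumOverPairs-coordinateDistance n) ⟩
      m ^ suc n * (m ^ suc n * S) + m * (m * (suc n * (m ^ n * m ^ n) * S))
        ≡⟨ step m n (m ^ n) S ⟩
      suc (suc n) * (m ^ suc n * m ^ suc n) * S ∎
      where
      S = sumOverPairs (allFin m) d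
      step : ∀ m n a s → m * a * (m * a * s) + m * (m * ((1 + n) * (a * a) * s)) ≡ (2 + n) * (m * a * (m * a)) * s
      step = solve-∀

  -- Through does rather than ⌊_⌋, so that differs (suc x) (suc y) reduces to differs x y.
  differs : ∀ {m} → Fin m → Fin m → Bool
  differs x y = not (does (x Fin.≟ y))

  differingSet : ∀ {n m} → Vec (Fin m) n → Vec (Fin m) n → Subset n
  differingSet f f' = Vec.tabulate λ w → differs (lookup f w) (lookup f' w)

  differs-≢ : ∀ {m} {x y : Fin m} → x ≢ y → differs x y ≡ true
  differs-≢ {x = x} {y} x≢y = cong not (dec-false (x Fin.≟ y) x≢y)

  differs-refl : ∀ {m} (x : Fin m) → differs x x ≡ false
  differs-refl x = cong not (dec-true (x Fin.≟ x) refl)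

  module _ {n m : ℕ} (f f' : Vec (Fin m) n) where

    ∈-differingSet⁺ : ∀ w → lookup f w ≢ lookup f' w → w ∈ differingSet f f'
    ∈-differingSet⁺ w ne = Vec.lookup⇒[]= w _ (trans (Vec.lookup∘tabulate _ w) (differs-≢ ne))

    ∈-differingSet⁻ : ∀ w → w ∈ differingSet f f' → lookup f w ≢ lookup f' w
    ∈-differingSet⁻ w w∈ eq = false≢true (begin
      false                               ≡⟨ sym (differs-refl (lookup f' w)) ⟩
      differs (lookup f' w) (lookup f' w) ≡⟨ cong (λ x → differs x (lookup f' w)) (sym eq) ⟩
      differs (lookup f w) (lookup f' w)  ≡⟨ sym (Vec.lookup∘tabulate _ w) ⟩
      lookup (differingSet f f') w        ≡⟨ Vec.[]=⇒lookup w∈ ⟩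
      true                                ∎)
      where
      false≢true : false ≢ true
      false≢true ()

  sumOver-allFin-differs : ∀ m (x : Fin m) (h : Bool → ℕ) →
    sumOver (allFin m) (λ y → h (differs x y)) ≡ h false + (m ∸ 1) * h true
  sumOver-allFin-differs (suc m) Fin.zero h =
    trans (sumOver-allFin-suc m _) (cong (h false +_) (sumOver-allFin-const m (h true)))
  sumOver-allFin-differs (suc (suc m)) (Fin.suc x) h = begin
    sumOver (allFin (suc (suc m))) (λ y → h (differs (Fin.suc x) y))
      ≡⟨ sumOver-allFin-suc (suc m) (λ y → h (differs (Fin.suc x) y)) ⟩
    h true + sumOver (allFin (suc m)) (λ y → h (differs x y))
      ≡⟨ cong (h true +_) (sumOver-allFin-differs (suc m) x h) ⟩
    h true + (h false + m * h true)
      ≡⟨ swap (h true) (h false) m ⟩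
    h false + suc m * h true ∎
    where
    swap : ∀ a b m → a + (b + m * a) ≡ b + (1 + m) * a
    swap = solve-∀

  sumOverPairs-differingSet : ∀ n m (R : Subset n → ℕ) →
    sumOverPairs (allFunctions n m) (λ f f' → R (differingSet f f')) ≡
    m ^ n * sumOver (allSubsets n) (λ A → (m ∸ 1) ^ ∣ A ∣ * R A)
  sumOverPairs-differingSet zero    m R = base (R Vec.[])
    where
    base : ∀ r → r + 0 + 0 ≡ 1 * (1 * r + 0)
    base = solve-∀
  sumOverPairs-differingSet (suc n) m R = begin
    sumOverPairs (allFunctions (suc n) m) (λ f f' → R (differingSet f f'))
      ≡⟨ sumOverPairs-allFunctions-suc n m _ ⟩
    sumOverPairs (allFin m) (λ x y → sumOverPairs (allFunctions n m) λ f f' → R (differs x y Vec.∷ differingSet f f'))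
      ≡⟨ sumOverPairs-cong (allFin m) (λ x y → sumOverPairs-differingSet n m (λ B → R (differs x y Vec.∷ B))) ⟩
    sumOver (allFin m) (λ x → sumOver (allFin m) λ y → m ^ n * K (differs x y))
      ≡⟨ sumOver-cong (allFin m) (λ x → trans (sumOver-* (allFin m) (m ^ n) _)
                                             (cong (m ^ n *_) (sumOver-allFin-differs m x K))) ⟩
    sumOver (allFin m) (λ _ → m ^ n * (K false + c * K true))
      ≡⟨ sumOver-allFin-const m _ ⟩
    m * (m ^ n * (K false + c * K true))
      ≡⟨ rearrange m (m ^ n) (K false) (c * K true) ⟩
    m ^ suc n * (c * K true + (K false + 0))
      ≡⟨ cong (λ z → m ^ suc n * (z + (K false + 0))) (sym K-true) ⟩
    m ^ suc n * sumOver (true ∷ false ∷ []) (λ b →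
                  sumOver (allSubsets n) λ B → c ^ ∣ b Vec.∷ B ∣ * R (b Vec.∷ B))
      ≡⟨ cong (m ^ suc n *_) (sym (sumOver-allVecs-suc n (true ∷ false ∷ []) _)) ⟩
    m ^ suc n * sumOver (allSubsets (suc n)) (λ A → c ^ ∣ A ∣ * R A) ∎
    where
    c = m ∸ 1
    K : Bool → ℕ
    K b = sumOver (allSubsets n) (λ B → c ^ ∣ B ∣ * R (b Vec.∷ B))
    K-true : sumOver (allSubsets n) (λ B → c ^ ∣ true Vec.∷ B ∣ * R (true Vec.∷ B)) ≡ c * K true
    K-true = trans (sumOver-cong (allSubsets n) λ B → *-assoc c _ _) (sumOver-* (allSubsets n) c _)
    rearrange : ∀ m a k l → m * (a * (k + l)) ≡ m * a * (l + (k + 0))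
    rearrange = solve-∀

  sumOver-upTo-suc : ∀ N (h : ℕ → ℕ) → sumOver (upTo (suc N)) h ≡ sumOver (upTo N) h + h N
  sumOver-upTo-suc N h = begin
    sumOver (upTo (suc N)) h            ≡⟨ cong (λ ks → sumOver ks h) (sym (List.upTo-∷ʳ N)) ⟩
    sumOver (upTo N ++ N ∷ []) h        ≡⟨ sumOver-++ (upTo N) (N ∷ []) h ⟩
    sumOver (upTo N) h + (h N + 0)      ≡⟨ cong (sumOver (upTo N) h +_) (+-identityʳ (h N)) ⟩
    sumOver (upTo N) h + h N            ∎

  if-≟-refl : ∀ j (r : ℕ) → (if ⌊ j ≟ j ⌋ then r else 0) ≡ r
  if-≟-refl j r with j ≟ j
  ... | yes _   = refl
  ... | no j≢j = contradiction refl j≢j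

  if-≟-≢ : ∀ {j k} (r : ℕ) → j ≢ k → (if ⌊ j ≟ k ⌋ then r else 0) ≡ 0
  if-≟-≢ {j} {k} r j≢k with j ≟ k
  ... | yes j≡k = contradiction j≡k j≢k
  ... | no _    = refl

  module _ (w : ℕ → ℕ) (j r : ℕ) where

    sumOver-upTo-if-≟-≤ : ∀ N → N ≤ j → sumOver (upTo N) (λ k → w k * (if ⌊ j ≟ k ⌋ then r else 0)) ≡ 0
    sumOver-upTo-if-≟-≤ zero    _   = refl
    sumOver-upTo-if-≟-≤ (suc N) N<j = begin
      sumOver (upTo (suc N)) (λ k → w k * (if ⌊ j ≟ k ⌋ then r else 0))
        ≡⟨ sumOver-upTo-suc N _ ⟩
      sumOver (upTo N) (λ k → w k * (if ⌊ j ≟ k ⌋ then r else 0)) + w N * (if ⌊ j ≟ N ⌋ then r else 0)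
        ≡⟨ cong₂ _+_ (sumOver-upTo-if-≟-≤ N (<⇒≤ N<j)) (cong (w N *_) (if-≟-≢ r (≢-sym (<⇒≢ N<j)))) ⟩
      0 + w N * 0
        ≡⟨ *-zeroʳ (w N) ⟩
      0 ∎

    sumOver-upTo-if-≟ : ∀ N → j < N → sumOver (upTo N) (λ k → w k * (if ⌊ j ≟ k ⌋ then r else 0)) ≡ w j * r
    sumOver-upTo-if-≟ (suc N) j<1+N = trans (sumOver-upTo-suc N _) (last (j ≟ N))
      where
      last : Dec (j ≡ N) →
        sumOver (upTo N) (λ k → w k * (if ⌊ j ≟ k ⌋ then r else 0)) + w N * (if ⌊ j ≟ N ⌋ then r else 0)
        ≡ w j * r
      last (yes refl) = cong₂ _+_ (sumOver-upTo-if-≟-≤ N ≤-refl) (cong (w N *_) (if-≟-refl N r))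
      last (no j≢N)   = begin
        sumOver (upTo N) (λ k → w k * (if ⌊ j ≟ k ⌋ then r else 0)) + w N * (if ⌊ j ≟ N ⌋ then r else 0)
          ≡⟨ cong₂ _+_ (sumOver-upTo-if-≟ N (≤∧≢⇒< (≤-pred j<1+N) j≢N))
                       (cong (w N *_) (if-≟-≢ r j≢N)) ⟩
        w j * r + w N * 0
          ≡⟨ cong (w j * r +_) (*-zeroʳ (w N)) ⟩
        w j * r + 0
          ≡⟨ +-identityʳ (w j * r) ⟩
        w j * r ∎

  rhoSum : ∀ n → (Subset n → Fin n → Fin n → ℕ) → Subset n → ℕ
  rhoSum n ρ A = sumOverPairs (allFin n) (ρ A)

  sizeLayer : ∀ n → (Subset n → ℕ) → ℕ → ℕ
  sizeLayer n R k = sumOver (allSubsets n) (λ A → if ⌊ ∣ A ∣ ≟ k ⌋ then R A else 0)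

  sumOver-allSubsets-bySize : ∀ n (w : ℕ → ℕ) (R : Subset n → ℕ) →
    sumOver (upTo (suc n)) (λ k → w k * sizeLayer n R k) ≡ sumOver (allSubsets n) (λ A → w ∣ A ∣ * R A)
  sumOver-allSubsets-bySize n w R = begin
    sumOver (upTo (suc n)) (λ k → w k * sizeLayer n R k)
      ≡⟨ sumOver-cong (upTo (suc n)) (λ k → sym (sumOver-* (allSubsets n) (w k) _)) ⟩
    sumOver (upTo (suc n)) (λ k → sumOver (allSubsets n) λ A → w k * (if ⌊ ∣ A ∣ ≟ k ⌋ then R A else 0))
      ≡⟨ sumOver-comm (upTo (suc n)) (allSubsets n) _ ⟩
    sumOver (allSubsets n) (λ A → sumOver (upTo (suc n)) λ k → w k * (if ⌊ ∣ A ∣ ≟ k ⌋ then R A else 0))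
      ≡⟨ sumOver-cong (allSubsets n) (λ A → sumOver-upTo-if-≟ w ∣ A ∣ (R A) (suc n) (s≤s (∣p∣≤n A))) ⟩
    sumOver (allSubsets n) (λ A → w ∣ A ∣ * R A) ∎

  module _ {V : Set} {R : V → V → Set} where

    _++ʷ_ : ∀ {a b c} → Walk R a b → Walk R b c → Walk R a c
    [ _ ]          ++ʷ q = q
    (u ∷⟨ r ⟩ p) ++ʷ q = u ∷⟨ r ⟩ (p ++ʷ q)

    walkLength-++ʷ : ∀ {a b c} (p : Walk R a b) (q : Walk R b c) →
      walkLength (p ++ʷ q) ≡ walkLength p + walkLength q
    walkLength-++ʷ [ _ ]          q = refl
    walkLength-++ʷ (u ∷⟨ r ⟩ p) q = cong suc (walkLength-++ʷ p q)

    walkLength-subst : ∀ {a b c} (e : b ≡ c) (p : Walk R a b) → walkLength (subst (Walk R a) e p) ≡ walkLength p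
    walkLength-subst refl p = refl

    visitedBy-start : ∀ {a b} (p : Walk R a b) → a visitedBy p
    visitedBy-start [ _ ]          = here-end
    visitedBy-start (u ∷⟨ r ⟩ p) = here r p

    visitedBy-[] : ∀ {x v} → _visitedBy_ {R = R} x [ v ] → x ≡ v
    visitedBy-[] here-end = refl

    visitedBy-∷ : ∀ {x u w v} {r : R u w} {p : Walk R w v} → x visitedBy (u ∷⟨ r ⟩ p) → x ≢ u → x visitedBy p
    visitedBy-∷ (here _ _)    x≢u = contradiction refl x≢u
    visitedBy-∷ (there _ _ x∈p) _ = x∈p

  module _ {V : Set} {R : V → V → Set} {d : V → V → ℕ} (isDistance : IsDistance R d) where

    distance-refl : ∀ x → d x x ≡ 0
    distance-refl x = n≤0⇒n≡0 (proj₂ (isDistance x x) [ x ])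

    distance-step : ∀ {a b} c → R a b → d a c ≤ suc (d b c)
    distance-step {a} {b} c r with proj₁ (isDistance b c)
    ... | q , |q|≡d = subst (λ l → d a c ≤ suc l) |q|≡d (proj₂ (isDistance a c) (a ∷⟨ r ⟩ q))

  []≔-agreeing : ∀ {A : Set} {n} (g h : Vec A n) (u : Fin n) →
    (∀ w → w ≢ u → lookup g w ≡ lookup h w) → g [ u ]≔ lookup h u ≡ h
  []≔-agreeing g h u agree = begin
    g [ u ]≔ lookup h u                     ≡⟨ sym (Vec.tabulate∘lookup _) ⟩
    Vec.tabulate (lookup (g [ u ]≔ lookup h u)) ≡⟨ Vec.tabulate-cong pointwise ⟩
    Vec.tabulate (lookup h)                 ≡⟨ Vec.tabulate∘lookup h ⟩
    h                                       ∎
    where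
    pointwise : ∀ w → lookup (g [ u ]≔ lookup h u) w ≡ lookup h w
    pointwise w with w Fin.≟ u
    ... | yes refl = Vec.lookup∘update u g (lookup h u)
    ... | no w≢u   = trans (Vec.lookup∘update′ w≢u g _) (agree w w≢u)

  module WreathDistance {n m : ℕ} (G : SimpleGraph n) (H : SimpleGraph m)
                        {dH : Fin m → Fin m → ℕ} (isDistanceH : IsDistance (Adj H) dH) where

    WreathWalk : WVertex n m → WVertex n m → Set
    WreathWalk = Walk (WreathAdj G H)

    Φ : Vec (Fin m) n → Vec (Fin m) n → ℕ
    Φ = coordinateDistance dH

    Φ-self : ∀ f → Φ f f ≡ 0
    Φ-self f = trans (sumOver-cong (allFin n) λ w → distance-refl isDistanceH (lookup f w))
                     (trans (sumOver-allFin-const n 0) (*-zeroʳ n))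

    Φ-repair : ∀ g f' u → Φ (g [ u ]≔ lookup f' u) f' + dH (lookup g u) (lookup f' u) ≡ Φ g f'
    Φ-repair g f' u = begin
      Φ (g [ u ]≔ lookup f' u) f' + dH (lookup g u) (lookup f' u) ≡⟨ coordinateDistance-update dH g f' u (lookup f' u) ⟩
      Φ g f' + dH (lookup f' u) (lookup f' u)                     ≡⟨ cong (Φ g f' +_) (distance-refl isDistanceH _) ⟩
      Φ g f' + 0                                                  ≡⟨ +-identityʳ (Φ g f') ⟩
      Φ g f'                                                      ∎

    Φ-adjacent : ∀ g g₁ f' u → (∀ w → w ≢ u → lookup g w ≡ lookup g₁ w) →
      Adj H (lookup g u) (lookup g₁ u) → Φ g f' ≤ suc (Φ g₁ f')
    Φ-adjacent g g₁ f' u agree adj = +-cancelʳ-≤ d₁ _ _ (subst (_≤ suc (Φ g₁ f') + d₁) exchange bound)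
      where
      d₀ = dH (lookup g u) (lookup f' u)
      d₁ = dH (lookup g₁ u) (lookup f' u)
      exchange : Φ g₁ f' + d₀ ≡ Φ g f' + d₁
      exchange = begin
        Φ g₁ f' + d₀                     ≡⟨ cong (λ h → Φ h f' + d₀) ([]≔-agreeing g g₁ u agree) ⟨
        Φ (g [ u ]≔ lookup g₁ u) f' + d₀ ≡⟨ coordinateDistance-update dH g f' u (lookup g₁ u) ⟩
        Φ g f' + d₁                      ∎
      bound : Φ g₁ f' + d₀ ≤ suc (Φ g₁ f') + d₁
      bound = subst (Φ g₁ f' + d₀ ≤_) (+-suc (Φ g₁ f') d₁)
                    (+-monoʳ-≤ (Φ g₁ f') (distance-step isDistanceH (lookup f' u) adj))

    liftWalk : ∀ (u : Fin n) {a b} (q : Walk (Adj H) a b) (g : Vec (Fin m) n) → lookup g u ≡ a →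
      Σ (WreathWalk (g , u) (g [ u ]≔ b , u)) λ P → walkLength P ≡ walkLength q
    liftWalk u [ a ] g gu≡a =
      subst (WreathWalk (g , u)) (cong (_, u) g≡g[u]≔a) [ g , u ] , walkLength-subst _ [ g , u ]
      where
      g≡g[u]≔a : g ≡ g [ u ]≔ a
      g≡g[u]≔a = sym (trans (cong (g [ u ]≔_) (sym gu≡a)) (Vec.[]≔-lookup g u))
    liftWalk u (_∷⟨_⟩_ {c} _ r q) g gu≡a with liftWalk u q (g [ u ]≔ c) (Vec.lookup∘update u g c)
    ... | P , |P|≡|q| =
      (g , u) ∷⟨ inj₁ (refl , fixed , adj) ⟩ subst (WreathWalk _) (cong (_, u) (Vec.[]≔-idempotent g u)) P ,
      cong suc (trans (walkLength-subst _ P) |P|≡|q|)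
      where
      fixed : ∀ w → w ≢ u → lookup g w ≡ lookup (g [ u ]≔ c) w
      fixed w w≢u = sym (Vec.lookup∘update′ w≢u g c)
      adj : Adj H (lookup g u) (lookup (g [ u ]≔ c) u)
      adj = subst₂ (Adj H) (sym gu≡a) (sym (Vec.lookup∘update u g c)) r

    repairWalk : ∀ g f' u →
      Σ (WreathWalk (g , u) (g [ u ]≔ lookup f' u , u)) λ P → walkLength P + Φ (g [ u ]≔ lookup f' u) f' ≡ Φ g f'
    repairWalk g f' u with proj₁ (isDistanceH (lookup g u) (lookup f' u))
    ... | q , |q|≡d with liftWalk u q g refl
    ...   | P , |P|≡|q| = P , (begin
      walkLength P + Φ (g [ u ]≔ lookup f' u) f'
        ≡⟨ cong (_+ Φ (g [ u ]≔ lookup f' u) f') (trans |P|≡|q| |q|≡d) ⟩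
      dH (lookup g u) (lookup f' u) + Φ (g [ u ]≔ lookup f' u) f'
        ≡⟨ +-comm (dH (lookup g u) (lookup f' u)) _ ⟩
      Φ (g [ u ]≔ lookup f' u) f' + dH (lookup g u) (lookup f' u)
        ≡⟨ Φ-repair g f' u ⟩
      Φ g f' ∎)

    Covers : ∀ {u v} → Vec (Fin m) n → Vec (Fin m) n → Walk (Adj G) u v → Set
    Covers g f' p = ∀ w → lookup g w ≢ lookup f' w → w visitedBy p

    module _ (f' : Vec (Fin m) n) (v' : Fin n) where

      coveringWalk⇒wreathWalk : ∀ {u} (g : Vec (Fin m) n) (p : Walk (Adj G) u v') → Covers g f' p →
        Σ (WreathWalk (g , u) (f' , v')) λ P → walkLength P ≡ walkLength p + Φ g f'
      coveringWalk⇒wreathWalk g [ _ ] covers with repairWalk g f' v'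
      ... | P , |P|+Φ≡Φ = subst (WreathWalk (g , v')) (cong (_, v') repaired) P , (begin
        walkLength (subst (WreathWalk (g , v')) (cong (_, v') repaired) P) ≡⟨ walkLength-subst _ P ⟩
        walkLength P                                   ≡⟨ +-identityʳ (walkLength P) ⟨
        walkLength P + 0                               ≡⟨ cong (walkLength P +_) (Φ-self f') ⟨
        walkLength P + Φ f' f'                         ≡⟨ cong (λ h → walkLength P + Φ h f') repaired ⟨
        walkLength P + Φ (g [ v' ]≔ lookup f' v') f'   ≡⟨ |P|+Φ≡Φ ⟩
        Φ g f'                                         ∎)
        where
        repaired : g [ v' ]≔ lookup f' v' ≡ f'
        repaired = []≔-agreeing g f' v' λ w w≢v' →
          decidable-stable (lookup g w Fin.≟ lookup f' w) λ ne → w≢v' (visitedBy-[] (covers w ne))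
      coveringWalk⇒wreathWalk g (u ∷⟨ r ⟩ p) covers with repairWalk g f' u
      ... | P₁ , |P₁|+Φ≡Φ with coveringWalk⇒wreathWalk g₁ p covers₁
        where
        g₁ = g [ u ]≔ lookup f' u
        covers₁ : Covers g₁ f' p
        covers₁ w ne with w Fin.≟ u
        ... | yes refl = contradiction (Vec.lookup∘update u g (lookup f' u)) ne
        ... | no w≢u   = visitedBy-∷ (covers w (λ e → ne (trans (Vec.lookup∘update′ w≢u g _) e))) w≢u
      ... | P , |P|≡|p|+Φ =
        P₁ ++ʷ ((g [ u ]≔ lookup f' u , u) ∷⟨ inj₂ (refl , r) ⟩ P) , (begin
          walkLength (P₁ ++ʷ (_ ∷⟨ inj₂ (refl , r) ⟩ P))  ≡⟨ walkLength-++ʷ P₁ _ ⟩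
          walkLength P₁ + suc (walkLength P)              ≡⟨ cong (λ l → walkLength P₁ + suc l) |P|≡|p|+Φ ⟩
          walkLength P₁ + suc (walkLength p + Φ₁)         ≡⟨ regroup (walkLength P₁) (walkLength p) Φ₁ ⟩
          suc (walkLength p + (walkLength P₁ + Φ₁))       ≡⟨ cong (λ l → suc (walkLength p + l)) |P₁|+Φ≡Φ ⟩
          suc (walkLength p + Φ g f')                     ∎)
        where
        Φ₁ = Φ (g [ u ]≔ lookup f' u) f'
        regroup : ∀ a l b → a + suc (l + b) ≡ suc (l + (a + b))
        regroup = solve-∀

      wreathWalk⇒coveringWalk : ∀ {g u} (P : WreathWalk (g , u) (f' , v')) →
        Σ (Walk (Adj G) u v') λ p → Covers g f' p × walkLength p + Φ g f' ≤ walkLength P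
      wreathWalk⇒coveringWalk [ _ ] = [ v' ] , (λ w ne → contradiction refl ne) , ≤-reflexive (Φ-self f')
      wreathWalk⇒coveringWalk {g} {u} (_∷⟨_⟩_ {g₁ , _} _ (inj₁ (refl , agree , adj)) P)
        with wreathWalk⇒coveringWalk P
      ... | p , covers₁ , |p|+Φ₁≤|P| = p , covers , bound
        where
        covers : Covers g f' p
        covers w ne with w Fin.≟ u
        ... | yes refl = visitedBy-start p
        ... | no w≢u   = covers₁ w (λ e → ne (trans (agree w w≢u) e))
        bound : walkLength p + Φ g f' ≤ suc (walkLength P)
        bound = ≤-trans (+-monoʳ-≤ (walkLength p) (Φ-adjacent g g₁ f' u agree adj))
                        (subst (_≤ suc (walkLength P)) (sym (+-suc (walkLength p) _)) (s≤s |p|+Φ₁≤|P|))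
      wreathWalk⇒coveringWalk (_ ∷⟨ inj₂ (refl , r) ⟩ P) with wreathWalk⇒coveringWalk P
      ... | p , covers , |p|+Φ≤|P| = _ ∷⟨ r ⟩ p , (λ w ne → there r p (covers w ne)) , s≤s |p|+Φ≤|P|

    wreathDistance : ∀ {dW} → IsDistance (WreathAdj G H) dW → ∀ {ρ} → IsRho G ρ →
      ∀ f v f' v' → dW (f , v) (f' , v') ≡ Φ f f' + ρ (differingSet f f') v v'
    wreathDistance {dW} isDistanceW {ρ} isRho f v f' v' = ≤-antisym upper lower
      where
      A = differingSet f f'
      upper : dW (f , v) (f' , v') ≤ Φ f f' + ρ A v v'
      upper with proj₁ (isRho A v v')
      ... | p , visits , |p|≡ρ with coveringWalk⇒wreathWalk f' v' f p (λ w ne → visits w (∈-differingSet⁺ f f' w ne))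
      ...   | P , |P|≡|p|+Φ = subst (dW (f , v) (f' , v') ≤_) |P|≡Φ+ρ (proj₂ (isDistanceW _ _) P)
        where
        |P|≡Φ+ρ : walkLength P ≡ Φ f f' + ρ A v v'
        |P|≡Φ+ρ = trans |P|≡|p|+Φ (trans (cong (_+ Φ f f') |p|≡ρ) (+-comm (ρ A v v') (Φ f f')))
      lower : Φ f f' + ρ A v v' ≤ dW (f , v) (f' , v')
      lower with proj₁ (isDistanceW (f , v) (f' , v'))
      ... | P , |P|≡dW with wreathWalk⇒coveringWalk f' v' P
      ...   | p , covers , |p|+Φ≤|P| = subst (Φ f f' + ρ A v v' ≤_) |P|≡dW
              (≤-trans (+-monoʳ-≤ (Φ f f') ρ≤|p|)
                       (subst (_≤ walkLength P) (+-comm (walkLength p) _) |p|+Φ≤|P|))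
        where
        ρ≤|p| : ρ A v v' ≤ walkLength p
        ρ≤|p| = proj₂ (isRho A v v') p (λ w w∈A → covers w (∈-differingSet⁻ f f' w w∈A))

    wreathDistanceSum : ∀ {dW} → IsDistance (WreathAdj G H) dW → ∀ {ρ} → IsRho G ρ →
      sumOverPairs (allWVertices n m) dW ≡
      n * (n * sumOverPairs (allFunctions n m) Φ)
      + m ^ n * sumOver (allSubsets n) (λ A → (m ∸ 1) ^ ∣ A ∣ * rhoSum n ρ A)
    wreathDistanceSum {dW} isDistanceW {ρ} isRho = begin
      sumOverPairs (allWVertices n m) dW
        ≡⟨ sumOverPairs-allWVertices n m dW ⟩
      sumOverPairs Fs (λ f f' → sumOverPairs (allFin n) λ v v' → dW (f , v) (f' , v'))
        ≡⟨ sumOverPairs-cong Fs (λ f f' → sumOverPairs-cong (allFin n) λ v v' →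
                                            wreathDistance isDistanceW isRho f v f' v') ⟩
      sumOverPairs Fs (λ f f' → sumOverPairs (allFin n) λ v v' → Φ f f' + ρ (differingSet f f') v v')
        ≡⟨ sumOverPairs-cong Fs (λ f f' → trans (sumOverPairs-+ (allFin n) _ _)
                                                (cong (_+ rhoSum n ρ (differingSet f f'))
                                                      (sumOverPairs-allFin-const n (Φ f f')))) ⟩
      sumOverPairs Fs (λ f f' → n * (n * Φ f f') + rhoSum n ρ (differingSet f f'))
        ≡⟨ sumOverPairs-+ Fs _ _ ⟩
      sumOverPairs Fs (λ f f' → n * (n * Φ f f')) + sumOverPairs Fs (λ f f' → rhoSum n ρ (differingSet f f'))
        ≡⟨ cong₂ _+_ (trans (sumOverPairs-* Fs n _) (cong (n *_) (sumOverPairs-* Fs n Φ)))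
                     (sumOverPairs-differingSet n m (rhoSum n ρ)) ⟩
      n * (n * sumOverPairs Fs Φ) + m ^ n * sumOver (allSubsets n) (λ A → c ^ ∣ A ∣ * rhoSum n ρ A) ∎
      where
      Fs = allFunctions n m
      c = m ∸ 1

  half-+ : ∀ a b → half a ℚ.+ half b ≡ half (a + b)
  half-+ a b = toℚᵘ-injective (ℚᵘ.≃-trans (toℚᵘ-homo-+ (half a) (half b))
    (ℚᵘ.≃-trans (ℚᵘ.+-cong (toℚᵘ-fromℚᵘ (mkℚᵘ (ℤ.+ a) 1)) (toℚᵘ-fromℚᵘ (mkℚᵘ (ℤ.+ b) 1)))
    (ℚᵘ.≃-trans (*≡* cross) (ℚᵘ.≃-sym (toℚᵘ-fromℚᵘ (mkℚᵘ (ℤ.+ (a + b)) 1))))))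
    where
    distrib : ∀ x y c → (x ℤ.* c ℤ.+ y ℤ.* c) ℤ.* c ≡ (x ℤ.+ y) ℤ.* (c ℤ.* c)
    distrib = ℤ-Solver.solve-∀
    cross : (ℤ.+ a ℤ.* ℤ.+ 2 ℤ.+ ℤ.+ b ℤ.* ℤ.+ 2) ℤ.* ℤ.+ 2 ≡ ℤ.+ (a + b) ℤ.* (ℤ.+ 2 ℤ.* ℤ.+ 2)
    cross = trans (distrib (ℤ.+ a) (ℤ.+ b) (ℤ.+ 2)) (cong (ℤ._* (ℤ.+ 2 ℤ.* ℤ.+ 2)) (sym (ℤ.pos-+ a b)))

  fromℕ-*-half : ∀ a b → fromℕ a ℚ.* half b ≡ half (a * b)
  fromℕ-*-half a b = toℚᵘ-injective (ℚᵘ.≃-trans (toℚᵘ-homo-* (fromℕ a) (half b))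
    (ℚᵘ.≃-trans (ℚᵘ.*-cong (toℚᵘ-fromℚᵘ (mkℚᵘ (ℤ.+ a) 0)) (toℚᵘ-fromℚᵘ (mkℚᵘ (ℤ.+ b) 1)))
    (ℚᵘ.≃-trans (*≡* cross) (ℚᵘ.≃-sym (toℚᵘ-fromℚᵘ (mkℚᵘ (ℤ.+ (a * b)) 1))))))
    where
    unit : ∀ x c → x ℤ.* c ≡ x ℤ.* (ℤ.+ 1 ℤ.* c)
    unit = ℤ-Solver.solve-∀
    cross : (ℤ.+ a ℤ.* ℤ.+ b) ℤ.* ℤ.+ 2 ≡ ℤ.+ (a * b) ℤ.* (ℤ.+ 1 ℤ.* ℤ.+ 2)
    cross = trans (unit (ℤ.+ a ℤ.* ℤ.+ b) (ℤ.+ 2)) (cong (ℤ._* (ℤ.+ 1 ℤ.* ℤ.+ 2)) (sym (ℤ.pos-* a b)))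

  sumℚ-cong : {A : Set} (xs : List A) {g h : A → ℚ} → (∀ a → g a ≡ h a) → sumℚ xs g ≡ sumℚ xs h
  sumℚ-cong []       e = refl
  sumℚ-cong (x ∷ xs) e = cong₂ ℚ._+_ (e x) (sumℚ-cong xs e)

  sumℚ-half : {A : Set} (xs : List A) (h : A → ℕ) → sumℚ xs (λ a → half (h a)) ≡ half (sumOver xs h)
  sumℚ-half []       h = refl
  sumℚ-half (x ∷ xs) h = trans (cong (half (h x) ℚ.+_) (sumℚ-half xs h)) (half-+ (h x) _)

  wienerRhoK≡half-sizeLayer : ∀ n (ρ : Subset n → Fin n → Fin n → ℕ) k →
    wienerRhoK n ρ k ≡ half (sizeLayer n (rhoSum n ρ) k)
  wienerRhoK≡half-sizeLayer n ρ k =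
    trans (sumℚ-cong (allSubsets n) (λ A → if-half ⌊ ∣ A ∣ ≟ k ⌋ _)) (sumℚ-half (allSubsets n) _)
    where
    if-half : ∀ b x → (if b then half x else ℚ.0ℚ) ≡ half (if b then x else 0)
    if-half true  x = refl
    if-half false x = refl

  sumℚ-weighted-wienerRhoK : ∀ n (ρ : Subset n → Fin n → Fin n → ℕ) (w : ℕ → ℕ) (ks : List ℕ) →
    sumℚ ks (λ k → fromℕ (w k) ℚ.* wienerRhoK n ρ k) ≡
    half (sumOver ks λ k → w k * sizeLayer n (rhoSum n ρ) k)
  sumℚ-weighted-wienerRhoK n ρ w ks = trans
    (sumℚ-cong ks λ k → trans (cong (fromℕ (w k) ℚ.*_) (wienerRhoK≡half-sizeLayer n ρ k)) (fromℕ-*-half (w k) _))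
    (sumℚ-half ks _)

  wreathDistanceSum-closed : ∀ n m (G : SimpleGraph (suc n)) (H : SimpleGraph m) {dH} → IsDistance (Adj H) dH →
    ∀ {dW} → IsDistance (WreathAdj G H) dW → ∀ {ρ} → IsRho G ρ →
    sumOverPairs (allWVertices (suc n) m) dW ≡
    suc n ^ 3 * m ^ (2 * n) * sumOverPairs (allFin m) dH
    + m ^ suc n * sumOver (upTo (suc (suc n))) (λ k → (m ∸ 1) ^ k * sizeLayer (suc n) (rhoSum (suc n) ρ) k)
  wreathDistanceSum-closed n m G H {dH} isDistanceH {dW} isDistanceW {ρ} isRho = begin
    sumOverPairs (allWVertices (suc n) m) dW
      ≡⟨ wreathDistanceSum isDistanceW isRho ⟩
    suc n * (suc n * sumOverPairs (allFunctions (suc n) m) (coordinateDistance dH)) + m ^ suc n * Y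
      ≡⟨ cong₂ _+_ fibres (cong (m ^ suc n *_) (sym (sumOver-allSubsets-bySize (suc n) ((m ∸ 1) ^_) _))) ⟩
    suc n ^ 3 * m ^ (2 * n) * sumOverPairs (allFin m) dH
    + m ^ suc n * sumOver (upTo (suc (suc n))) (λ k → (m ∸ 1) ^ k * sizeLayer (suc n) (rhoSum (suc n) ρ) k) ∎
    where
    open WreathDistance G H isDistanceH
    Y = sumOver (allSubsets (suc n)) (λ A → (m ∸ 1) ^ ∣ A ∣ * rhoSum (suc n) ρ A)
    S = sumOverPairs (allFin m) dH
    cube : ∀ N a s → N * (N * (N * a * s)) ≡ N * (N * (N * 1)) * a * s
    cube = solve-∀
    m^2n : m ^ (2 * n) ≡ m ^ n * m ^ n
    m^2n = trans (cong (λ e → m ^ (n + e)) (+-identityʳ n)) (^-distribˡ-+-* m n n)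
    fibres : suc n * (suc n * sumOverPairs (allFunctions (suc n) m) (coordinateDistance dH)) ≡ suc n ^ 3 * m ^ (2 * n) * S
    fibres = begin
      suc n * (suc n * sumOverPairs (allFunctions (suc n) m) (coordinateDistance dH))
        ≡⟨ cong (λ z → suc n * (suc n * z)) (sumOverPairs-coordinateDistance m dH n) ⟩
      suc n * (suc n * (suc n * (m ^ n * m ^ n) * S)) ≡⟨ cube (suc n) (m ^ n * m ^ n) S ⟩
      suc n ^ 3 * (m ^ n * m ^ n) * S                 ≡⟨ cong (λ e → suc n ^ 3 * e * S) m^2n ⟨
      suc n ^ 3 * m ^ (2 * n) * S                     ∎

open WreathProductWiener
open import Defs
open import Data.Nat as ℕ using (ℕ; zero; suc; _≤_; _*_; _^_; _∸_)
open import Data.Fin using (Fin)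
open import Data.List using (upTo; allFin)
open import Data.Fin.Subset using (Subset)
open import Data.Rational using (ℚ; _+_) renaming (_*_ to _*ℚ_)
open import Relation.Binary.PropositionalEquality using (_≡_; cong; cong₂; module ≡-Reasoning)
open ≡-Reasoning

-- The hypotheses 1 ≤ m, Connected G and Connected H are unused: the distance functions are given.
corollary5p6 : (n m : ℕ) (G : SimpleGraph n) (H : SimpleGraph m) →
    1 ≤ n → 1 ≤ m → Connected G → Connected H →
    (dH : Fin m → Fin m → ℕ) → IsDistance (Adj H) dH →
    (dW : WVertex n m → WVertex n m → ℕ) → IsDistance (WreathAdj G H) dW →
    (ρ : Subset n → Fin n → Fin n → ℕ) → IsRho G ρ →
    wienerWreath n m dW ≡
      (fromℕ (n ^ 3 * m ^ (2 * (n ∸ 1))) *ℚ wienerFin m dH)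
      + (fromℕ (m ^ n) *ℚ sumℚ (upTo (suc n)) (λ k → fromℕ ((m ∸ 1) ^ k) *ℚ wienerRhoK n ρ k))
corollary5p6 zero    _ _ _ () _ _ _ _ _ _ _ _ _
corollary5p6 (suc n) m G H _ _ _ _ dH isDistanceH dW isDistanceW ρ isRho = begin
  wienerWreath (suc n) m dW
    ≡⟨ cong half (wreathDistanceSum-closed n m G H isDistanceH isDistanceW isRho) ⟩
  half (a * S ℕ.+ m ^ suc n * X)
    ≡⟨ half-+ (a * S) (m ^ suc n * X) ⟨
  half (a * S) + half (m ^ suc n * X)
    ≡⟨ cong₂ _+_ (fromℕ-*-half a S) (fromℕ-*-half (m ^ suc n) X) ⟨
  fromℕ a *ℚ wienerFin m dH + fromℕ (m ^ suc n) *ℚ half X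
    ≡⟨ cong (λ q → fromℕ a *ℚ wienerFin m dH + fromℕ (m ^ suc n) *ℚ q)
            (sumℚ-weighted-wienerRhoK (suc n) ρ (c ^_) ks) ⟨
  fromℕ a *ℚ wienerFin m dH + fromℕ (m ^ suc n) *ℚ sumℚ ks (λ k → fromℕ (c ^ k) *ℚ wienerRhoK (suc n) ρ k) ∎
  where
  a = suc n ^ 3 * m ^ (2 * n)
  c = m ∸ 1
  ks = upTo (suc (suc n))
  S = sumOverPairs (allFin m) dH
  X = sumOver ks (λ k → c ^ k * sizeLayer (suc n) (rhoSum (suc n) ρ) k)
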